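{- Every $5/4$-power over $\Sigma_8$ is a pre-$5/4$-power.
   Context: Let $\Sigma_8=\{n_j : n\in\mathbb{Z},\ 0\le j\le 7\}$ be the infinite alphabet of distinct formal symbols $n_j$. Let $\varphi$ be the $6$-uniform morphism on $\Sigma_8$ (extended to words by concatenation) defined for all $n\in\mathbb{Z}$ by $\varphi(n_0)=0_0 1_1 0_2 0_3 1_4 (n+3)_5$, $\varphi(n_1)=1_6 1_7 0_0 0_1 0_2 (n+2)_3$, $\varphi(n_2)=1_4 1_5 1_6 0_7 0_0 (n+3)_1$, $\varphi(n_3)=0_2 1_3 1_4 0_5 1_6 (n+2)_7$, $\varphi(n_4)=0_0 1_1 0_2 0_3 1_4 (n+1)_5$, $\varphi(n_5)=1_6 1_7 0_0 0_1 0_2 (n+2)_3$, $\varphi(n_6)=1_4 1_5 1_6 0_7 0_0 (n+1)_1$, $\varphi(n_7)=0_2 1_3 1_4 0_5 1_6 (n+2)_7$. A $5/4$-power is a word $xyx$ with $|x|\ge1$ and $|y|=3|x|$. A word $w$ over $\Sigma_8$ is a pre-$5/4$-power if $\varphi(w)$ is a $5/4$-power. -}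

module Defs where

open import Data.Integer using (ℤ; _+_; +_)
open import Data.Fin using (Fin; zero; suc)
open import Data.Nat using (ℕ; _≤_; _*_)
open import Data.List using (List; []; _∷_; _++_; length; concatMap)
open import Data.Product using (_×_; _,_; Σ-syntax)
open import Relation.Binary.PropositionalEquality using (_≡_)

-- The symbol n_j of Σ₈ is represented by the pair (n , j).
Σ₈ : Set
Σ₈ = ℤ × Fin 8

Word : Set
Word = List Σ₈

sym : ℤ → Fin 8 → Σ₈
sym n j = n , j

j0 j1 j2 j3 j4 j5 j6 j7 : Fin 8
j0 = zero
j1 = suc zero
j2 = suc (suc zero)
j3 = suc (suc (suc zero))
j4 = suc (suc (suc (suc zero)))
j5 = suc (suc (suc (suc (suc zero))))
j6 = suc (suc (suc (suc (suc (suc zero)))))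
j7 = suc (suc (suc (suc (suc (suc (suc zero))))))

z o : ℤ
z = + 0
o = + 1

φ₁ : Σ₈ → Word
φ₁ (n , zero) =
  sym z j0 ∷ sym o j1 ∷ sym z j2 ∷ sym z j3 ∷ sym o j4 ∷ sym (n + + 3) j5 ∷ []
φ₁ (n , suc zero) =
  sym o j6 ∷ sym o j7 ∷ sym z j0 ∷ sym z j1 ∷ sym z j2 ∷ sym (n + + 2) j3 ∷ []
φ₁ (n , suc (suc zero)) =
  sym o j4 ∷ sym o j5 ∷ sym o j6 ∷ sym z j7 ∷ sym z j0 ∷ sym (n + + 3) j1 ∷ []
φ₁ (n , suc (suc (suc zero))) =
  sym z j2 ∷ sym o j3 ∷ sym o j4 ∷ sym z j5 ∷ sym o j6 ∷ sym (n + + 2) j7 ∷ []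
φ₁ (n , suc (suc (suc (suc zero)))) =
  sym z j0 ∷ sym o j1 ∷ sym z j2 ∷ sym z j3 ∷ sym o j4 ∷ sym (n + + 1) j5 ∷ []
φ₁ (n , suc (suc (suc (suc (suc zero))))) =
  sym o j6 ∷ sym o j7 ∷ sym z j0 ∷ sym z j1 ∷ sym z j2 ∷ sym (n + + 2) j3 ∷ []
φ₁ (n , suc (suc (suc (suc (suc (suc zero)))))) =
  sym o j4 ∷ sym o j5 ∷ sym o j6 ∷ sym z j7 ∷ sym z j0 ∷ sym (n + + 1) j1 ∷ []
φ₁ (n , suc (suc (suc (suc (suc (suc (suc zero))))))) =
  sym z j2 ∷ sym o j3 ∷ sym o j4 ∷ sym z j5 ∷ sym o j6 ∷ sym (n + + 2) j7 ∷ []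

φ : Word → Word
φ = concatMap φ₁

Is5/4Power : Word → Set
Is5/4Power w = Σ[ x ∈ Word ] Σ[ y ∈ Word ]
  (1 ≤ length x × length y ≡ 3 * length x × w ≡ x ++ y ++ x)

IsPre5/4Power : Word → Set
IsPre5/4Power w = Is5/4Power (φ w)

-- A k-uniform morphism h with k ≥ 1 is a monoid homomorphism that multiplies
-- lengths by k, so it sends x y x to h(x) h(y) h(x) with |h(y)| = 3 k |x| = 3 |h(x)|
-- and |h(x)| ≥ |x| ≥ 1. The morphism φ is 6-uniform.
module Submission where

open import Defs
open import Data.Nat using (_+_; _*_; _≤_; NonZero)
open import Data.Nat.Properties using (*-suc; *-assoc; *-comm; m≤n*m; ≤-trans)
open import Data.List using (List; []; _∷_; _++_; length; concatMap)
open import Data.List.Properties using (length-++; concatMap-++)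
open import Data.Product using (_,_)
open import Data.Fin using (zero; suc)
open import Relation.Binary.PropositionalEquality
  using (_≡_; refl; cong; cong₂; trans; module ≡-Reasoning)
  renaming (sym to ≡-sym)

length-concatMap-uniform : ∀ {A B : Set} {k} (f : A → List B) → (∀ a → length (f a) ≡ k) →
                           ∀ xs → length (concatMap f xs) ≡ k * length xs
length-concatMap-uniform {k = k} f uniform [] = ≡-sym (*-comm k 0)
length-concatMap-uniform {k = k} f uniform (a ∷ xs) = begin
  length (f a ++ concatMap f xs)              ≡⟨ length-++ (f a) ⟩
  length (f a) + length (concatMap f xs)      ≡⟨ cong₂ _+_ (uniform a)
                                                   (length-concatMap-uniform f uniform xs) ⟩
  k + k * length xs                           ≡⟨ ≡-sym (*-suc k (length xs)) ⟩
  k * length (a ∷ xs)                         ∎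
  where open ≡-Reasoning

uniform-morphism-preserves-5/4-power :
  ∀ k .{{_ : NonZero k}} (f : Σ₈ → Word) → (∀ a → length (f a) ≡ k) →
  ∀ w → Is5/4Power w → Is5/4Power (concatMap f w)
uniform-morphism-preserves-5/4-power k f uniform w (x , y , |x|≥1 , |y|≡3|x| , refl) =
  h x , h y , |hx|≥1 , |hy|≡3|hx| , h-xyx
  where
  h : Word → Word
  h = concatMap f

  length-h : ∀ u → length (h u) ≡ k * length u
  length-h = length-concatMap-uniform f uniform

  |hx|≥1 : 1 ≤ length (h x)
  |hx|≥1 rewrite length-h x = ≤-trans |x|≥1 (m≤n*m (length x) k)

  |hy|≡3|hx| : length (h y) ≡ 3 * length (h x)
  |hy|≡3|hx| = begin
    length (h y)        ≡⟨ length-h y ⟩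
    k * length y        ≡⟨ cong (k *_) |y|≡3|x| ⟩
    k * (3 * length x)  ≡⟨ ≡-sym (*-assoc k 3 (length x)) ⟩
    k * 3 * length x    ≡⟨ cong (_* length x) (*-comm k 3) ⟩
    3 * k * length x    ≡⟨ *-assoc 3 k (length x) ⟩
    3 * (k * length x)  ≡⟨ cong (3 *_) (≡-sym (length-h x)) ⟩
    3 * length (h x)    ∎
    where open ≡-Reasoning

  h-xyx : h (x ++ y ++ x) ≡ h x ++ h y ++ h x
  h-xyx = trans (concatMap-++ f x (y ++ x)) (cong (h x ++_) (concatMap-++ f y x))

length-φ₁ : ∀ a → length (φ₁ a) ≡ 6
length-φ₁ (n , zero) = refl
length-φ₁ (n , suc zero) = refl
length-φ₁ (n , suc (suc zero)) = refl
length-φ₁ (n , suc (suc (suc zero))) = refl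
length-φ₁ (n , suc (suc (suc (suc zero)))) = refl
length-φ₁ (n , suc (suc (suc (suc (suc zero))))) = refl
length-φ₁ (n , suc (suc (suc (suc (suc (suc zero)))))) = refl
length-φ₁ (n , suc (suc (suc (suc (suc (suc (suc zero))))))) = refl

proposition4p4 : (w : Word) → Is5/4Power w → IsPre5/4Power w
proposition4p4 = uniform-morphism-preserves-5/4-power 6 φ₁ length-φ₁
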